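{- Let $P$ be a labelled logic program over a finite signature $\mathit{At}$ and let $I\subseteq\mathit{At}$ be a model of $P$. Then $G$ is an explanation for $I$ under $P$ if and only if $G$ is an explanation for $I$ under $P^I$.
   Context: Fix a finite non-empty set $\mathit{At}$ of propositional atoms. A labelled rule $r$ has the form $\ell : p_1 \vee \dots \vee p_m \leftarrow q_1 \wedge \dots \wedge q_n \wedge \neg s_1 \wedge \dots \wedge \neg s_j \wedge \neg\neg t_1 \wedge \dots \wedge \neg\neg t_k$ with all atoms in $\mathit{At}$ and $m,n,j,k\ge 0$. Its label is $\mathit{Lb}(r)=\ell$, its head $\mathit{Head}(r)$ is $p_1\vee\dots\vee p_m$ with head atoms $H(r)=\{p_1,\dots,p_m\}$, its body $\mathit{Body}(r)$ is the conjunction on the right, its positive body is $\mathit{Body}^+(r)=q_1\wedge\dots\wedge q_n$ with atoms $B^+(r)=\{q_1,\dots,q_n\}$, and its negative body $\mathit{Body}^-(r)$ is the conjunction of the remaining literals; empty disjunction is $\bot$, empty conjunction is $\top$. A labelled program is a set of labelled rules with no repeated label; $\mathit{Lb}(P)$ is its set of labels. An interpretation $I\subseteq\mathit{At}$ is a model of $P$ if it classically satisfies $\mathit{Body}(r)\to\mathit{Head}(r)$ for every $r\in P$. The reduct is $P^I=\{\mathit{Lb}(r):\mathit{Head}(r)\leftarrow\mathit{Body}^+(r)\mid r\in P,\ I\models\mathit{Body}^-(r)\}$ (again a labelled program). $\mathit{Sup}(I,Q,p)=\{r\in Q\mid p\in H(r),\ I\models\mathit{Body}(r)\}$. A support graph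 of a model $I$ of a labelled program $Q$ is $G=\langle I,E,\lambda\rangle$ with vertices $I$, edges $E\subseteq I\times I$, $\lambda:I\to\mathit{Lb}(Q)$, such that (i) $\lambda$ is injective and (ii) for every $p\in I$ the rule $r\in Q$ with $\mathit{Lb}(r)=\lambda(p)$ satisfies $r\in\mathit{Sup}(I,Q,p)$ and $B^+(r)=\{q\mid(q,p)\in E\}$; an explanation for $I$ under $Q$ is an acyclic support graph of $I$ under $Q$. -}

module Defs where

open import Data.Nat using (ℕ; suc)
open import Data.Fin using (Fin)
open import Data.Fin.Subset using (Subset; _∈_; _∉_)
open import Data.Fin.Subset.Properties using (_∈?_)
open import Data.Bool using (Bool; true)
open import Data.List using (List; []; _∷_; map)
open import Data.List.Relation.Unary.All using (All; all?)
open import Data.List.Relation.Unary.Any using (Any)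
open import Data.List.Relation.Unary.Unique.Propositional using (Unique)
import Data.List.Membership.Propositional as LMem
open import Data.Product using (Σ; ∃; _×_; _,_)
open import Relation.Nullary using (¬_; Dec; yes; no; ¬?)
open import Relation.Nullary.Decidable using (_×-dec_)
open import Relation.Binary.PropositionalEquality using (_≡_)
open import Relation.Binary.Construct.Closure.Transitive using (TransClosure)

-- Atoms: At = Fin (suc n)  (finite, non-empty).  Labels: an arbitrary type L.

-- ℓ : p₁ ∨ … ∨ pₘ ← q₁ ∧ … ∧ qₙ ∧ ¬s₁ ∧ … ∧ ¬sⱼ ∧ ¬¬t₁ ∧ … ∧ ¬¬tₖ
record Rule (n : ℕ) (L : Set) : Set where
  constructor rule
  field
    label  : L
    head   : List (Fin n)
    pos    : List (Fin n)
    neg    : List (Fin n)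
    negneg : List (Fin n)
open Rule public

Program : ℕ → Set → Set
Program n L = List (Rule n L)

Lb : ∀ {n L} → Program n L → List L
Lb P = map label P

Labelled : ∀ {n L} → Program n L → Set
Labelled P = Unique (Lb P)

Interp : ℕ → Set
Interp n = Subset n

_⊨Head_ : ∀ {n L} → Interp n → Rule n L → Set
I ⊨Head r = Any (λ p → p ∈ I) (head r)

_⊨Body⁺_ : ∀ {n L} → Interp n → Rule n L → Set
I ⊨Body⁺ r = All (λ q → q ∈ I) (pos r)

_⊨Body⁻_ : ∀ {n L} → Interp n → Rule n L → Set
I ⊨Body⁻ r = All (λ s → ¬ (s ∈ I)) (neg r) × All (λ t → ¬ ¬ (t ∈ I)) (negneg r)

_⊨Body_ : ∀ {n L} → Interp n → Rule n L → Set
I ⊨Body r = (I ⊨Body⁺ r) × (I ⊨Body⁻ r)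

_⊨Body⁻?_ : ∀ {n L} (I : Interp n) (r : Rule n L) → Dec (I ⊨Body⁻ r)
I ⊨Body⁻? r = all? (λ s → ¬? (s ∈? I)) (neg r) ×-dec all? (λ t → ¬? (¬? (t ∈? I))) (negneg r)

IsModel : ∀ {n L} → Interp n → Program n L → Set
IsModel I P = ∀ {r} → r LMem.∈ P → I ⊨Body r → I ⊨Head r

strip : ∀ {n L} → Rule n L → Rule n L
strip r = rule (label r) (head r) (pos r) [] []

reduct : ∀ {n L} → Interp n → Program n L → Program n L
reduct I [] = []
reduct I (r ∷ P) with I ⊨Body⁻? r
... | yes _ = strip r ∷ reduct I P
... | no  _ = reduct I P

InSup : ∀ {n L} → Interp n → Program n L → Fin n → Rule n L → Set
InSup I Q p r = (r LMem.∈ Q) × (p LMem.∈ head r) × (I ⊨Body r)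

-- a graph ⟨I, E, λ⟩ on vertex set I: edges as a Boolean relation, labelling on vertices
record Graph (n : ℕ) (L : Set) (I : Interp n) : Set where
  constructor graph
  field
    E   : Fin n → Fin n → Bool
    lab : (p : Fin n) → p ∈ I → L
open Graph public

Edge : ∀ {n L I} → Graph n L I → Fin n → Fin n → Set
Edge G q p = E G q p ≡ true

IsSupportGraph : ∀ {n L} (I : Interp n) → Program n L → Graph n L I → Set
IsSupportGraph {n} I Q G =
    (∀ q p → Edge G q p → (q ∈ I) × (p ∈ I))
  × (∀ p (p∈I : p ∈ I) → lab G p p∈I LMem.∈ Lb Q)
  × (∀ p q (p∈I : p ∈ I) (q∈I : q ∈ I) → lab G p p∈I ≡ lab G q q∈I → p ≡ q)
  × (∀ p (p∈I : p ∈ I) → Σ (Rule n _) λ r →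
        (label r ≡ lab G p p∈I) × InSup I Q p r
        × (∀ q → (q LMem.∈ pos r → Edge G q p) × (Edge G q p → q LMem.∈ pos r)))

Acyclic : ∀ {n L I} → Graph n L I → Set
Acyclic {n} G = ∀ (p : Fin n) → ¬ TransClosure (Edge G) p p

IsExplanation : ∀ {n L} (I : Interp n) → Program n L → Graph n L I → Set
IsExplanation I Q G = IsSupportGraph I Q G × Acyclic G

-- A rule r supports p under P exactly when its stripped version strip r supports p under P^I:
-- I ⊨ Body(r) splits into I ⊨ Body⁺(r), which strip r keeps, and I ⊨ Body⁻(r), which is the
-- condition for strip r to enter the reduct. Stripping preserves labels, heads and positive
-- bodies, so labelling, edges and acyclicity of a support graph are untouched.
module Submission where

open import Defs
open import Data.Nat using (ℕ; suc)
import Data.Fin.Subset as Subset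
open import Data.List using (_∷_)
open import Data.List.Relation.Unary.Any using (here; there)
open import Data.List.Relation.Unary.All using ([])
open import Data.List.Membership.Propositional using (_∈_)
open import Data.List.Membership.Propositional.Properties using (∈-map⁺)
open import Data.Product using (Σ; _×_; _,_)
open import Function.Bundles using (_⇔_; mk⇔)
open import Relation.Nullary using (yes; no; contradiction)
open import Relation.Binary.PropositionalEquality using (_≡_; refl; subst)

module _ {n : ℕ} {L : Set} (I : Interp n) where

  strip-∈-reduct : ∀ (P : Program n L) {r} → r ∈ P → I ⊨Body⁻ r → strip r ∈ reduct I P
  strip-∈-reduct (r ∷ P) (here refl) b⁻ with I ⊨Body⁻? r
  ... | yes _  = here refl
  ... | no ¬b⁻ = contradiction b⁻ ¬b⁻
  strip-∈-reduct (r ∷ P) (there r∈P) b⁻ with I ⊨Body⁻? r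
  ... | yes _ = there (strip-∈-reduct P r∈P b⁻)
  ... | no _  = strip-∈-reduct P r∈P b⁻

  ∈-reduct⁻ : ∀ (P : Program n L) {r′} → r′ ∈ reduct I P →
              Σ (Rule n L) λ r → r ∈ P × I ⊨Body⁻ r × r′ ≡ strip r
  ∈-reduct⁻ (r ∷ P) r′∈ with I ⊨Body⁻? r
  ∈-reduct⁻ (r ∷ P) (here refl) | yes b⁻ = r , here refl , b⁻ , refl
  ∈-reduct⁻ (r ∷ P) (there r′∈) | yes _ with ∈-reduct⁻ P r′∈
  ... | s , s∈P , b⁻ , refl = s , there s∈P , b⁻ , refl
  ∈-reduct⁻ (r ∷ P) r′∈ | no _ with ∈-reduct⁻ P r′∈
  ... | s , s∈P , b⁻ , refl = s , there s∈P , b⁻ , refl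

  Simulates : Program n L → Program n L → Set
  Simulates Q Q′ = ∀ {p r} → InSup I Q p r →
    Σ (Rule n L) λ r′ → label r′ ≡ label r × pos r′ ≡ pos r × InSup I Q′ p r′

  reduct-simulates : ∀ P → Simulates P (reduct I P)
  reduct-simulates P {r = r} (r∈P , p∈head , b⁺ , b⁻) =
    strip r , refl , refl , strip-∈-reduct P r∈P b⁻ , p∈head , b⁺ , [] , []

  simulates-reduct : ∀ P → Simulates (reduct I P) P
  simulates-reduct P (r′∈ , p∈head , b⁺ , _) with ∈-reduct⁻ P r′∈
  ... | r , r∈P , b⁻ , refl = r , refl , refl , r∈P , p∈head , b⁺ , b⁻

  IsSupportGraph-resp-Simulates : ∀ {Q Q′} → Simulates Q Q′ →
    (G : Graph n L I) → IsSupportGraph I Q G → IsSupportGraph I Q′ G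
  IsSupportGraph-resp-Simulates {Q′ = Q′} sim G (edges⊆I , _ , lab-injective , supported) =
    edges⊆I , lab∈Lb , lab-injective , supported′
    where
    supported′ : ∀ p (p∈I : p Subset.∈ I) → Σ (Rule n L) λ r →
      label r ≡ lab G p p∈I × InSup I Q′ p r
      × (∀ q → (q ∈ pos r → Edge G q p) × (Edge G q p → q ∈ pos r))
    supported′ p p∈I with supported p p∈I
    ... | r , refl , sup , preds with sim sup
    ... | r′ , label≡ , refl , sup′ = r′ , label≡ , sup′ , preds

    lab∈Lb : ∀ p (p∈I : p Subset.∈ I) → lab G p p∈I ∈ Lb Q′
    lab∈Lb p p∈I with supported′ p p∈I
    ... | r , refl , (r∈Q′ , _) , _ = ∈-map⁺ label r∈Q′

  IsExplanation-resp-Simulates : ∀ {Q Q′} → Simulates Q Q′ →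
    (G : Graph n L I) → IsExplanation I Q G → IsExplanation I Q′ G
  IsExplanation-resp-Simulates sim G (support , acyclic) =
    IsSupportGraph-resp-Simulates sim G support , acyclic

proposition3 : (n : ℕ) (L : Set) (P : Program (suc n) L) → Labelled P →
    (I : Interp (suc n)) → IsModel I P →
    (G : Graph (suc n) L I) →
    IsExplanation I P G ⇔ IsExplanation I (reduct I P) G
proposition3 n L P _ I _ G =
  mk⇔ (IsExplanation-resp-Simulates I (reduct-simulates I P) G)
      (IsExplanation-resp-Simulates I (simulates-reduct I P) G)
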